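{- Let $B_C$ be a uniformly random bay with $C$ columns and $h$ containers per column. Then $\mathbb{E}_C[S_0(B_C)] = \alpha_h C$, where $\alpha_h = \sum_{k=1}^{h-1} k\, p_{k,h}$ and $p_{k,h}$ is the probability that a column of $h$ containers whose relative order is uniformly random contains exactly $k$ blocking containers. Moreover these probabilities satisfy $p_{0,m} = \frac{1}{m!}$ for all $m\ge 0$, and for $1\le k\le h-1$, $$p_{k,h} = \sum_{j=1}^{k+1} \frac{1}{h}\, p_{k-j+1,\,h-j},$$ with the convention $p_{k',m} = 0$ whenever $m \ge 1$ and $k' \ge m$.
   Context: A bay has $C$ columns and $P$ tiers ($P\ge3$), and $h \le P-1$. A uniformly random bay with $C$ columns and $h$ containers per column ($N = hC$ containers labelled $1,\dots,N$ by retrieval order) is generated by drawing a uniformly random permutation $\pi$ of $\{1,\dots,hC\}$ and placing container $\pi(h(i-1)+j)$ in column $i$ at tier $j$ (counted from the bottom) for $j\le h$, tiers above $h$ being empty. $\mathbb{E}_C$ denotes expectation under this distribution. A container is blocking if it lies above some container with a smaller label in the same column; $S_0(B)$ is the number of blocking containers of $B$. -}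

module Defs where

open import Data.Bool using (Bool; true; false; _∧_)
open import Data.Nat using (ℕ; zero; suc; _*_; _∸_; _<ᵇ_; _!)
open import Data.Fin using (Fin; toℕ; combine)
open import Data.Vec using (Vec; []; _∷_; lookup; toList)
open import Data.List using (List; []; _∷_; map; concatMap; length; filter; filterᵇ; allFin; foldr; upTo)
open import Data.Bool.ListAction using (any)
open import Data.Fin.Properties using (_≟_)
import Data.List.Relation.Unary.Unique.DecPropositional as UDP
open import Data.Integer using (+_)
open import Data.Rational using (ℚ; 0ℚ; _+_; _/_)
open import Data.Nat.Properties using (_!≢0)
open import Relation.Nullary.Negation using (contradiction)

allVecs : ∀ {n} (k : ℕ) → List (Vec (Fin n) k)
allVecs zero = [] ∷ []
allVecs {n} (suc k) = concatMap (λ x → map (x ∷_) (allVecs k)) (allFin n)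

-- all permutations of {0,…,n-1}, a permutation π being the sequence π(0),…,π(n-1)
-- (all vectors of length n over Fin n whose entries are pairwise distinct)
perms : (n : ℕ) → List (Vec (Fin n) n)
perms n = filter (λ v → UDP.unique? _≟_ (toList v)) (allVecs n)

-- a column given by its labels f (tier t = 0 is the bottom):
-- the container at tier t is blocking iff some lower tier t' carries a smaller label
isBlocking : ∀ {h N} → (Fin h → Fin N) → Fin h → Bool
isBlocking {h} f t = any (λ t' → (toℕ t' <ᵇ toℕ t) ∧ (toℕ (f t') <ᵇ toℕ (f t))) (allFin h)

blockingInColumn : ∀ {h N} → (Fin h → Fin N) → ℕ
blockingInColumn {h} f = length (filterᵇ (isBlocking f) (allFin h))

sumℕ : List ℕ → ℕ
sumℕ = foldr Data.Nat._+_ 0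

sumℚ : List ℚ → ℚ
sumℚ = foldr _+_ 0ℚ

-- The bay generated by π : container π(h·i + j) sits in column i, tier j
-- (0-based; combine i j = i * h + j).
-- S₀ of that bay: total number of blocking containers.
S₀ : (C h : ℕ) → Vec (Fin (C * h)) (C * h) → ℕ
S₀ C h π = sumℕ (map (λ i → blockingInColumn (λ j → lookup π (combine i j))) (allFin C))

expectedS₀ : (C h : ℕ) → ℚ
expectedS₀ C h = ((+ sumℕ (map (S₀ C h) (perms (C * h)))) / ((C * h) !)) {{(C * h) !≢0}}

p : (k m : ℕ) → ℚ
p k m = ((+ length (filterᵇ (λ σ → blockingInColumn (lookup σ) Data.Nat.≡ᵇ k) (perms m))) / (m !)) {{m !≢0}}

α : ℕ → ℚ
α h = sumℚ (map (λ k → (+ k / 1) Data.Rational.* p k h) (map suc (upTo (h ∸ 1))))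

-- 1/n as a rational (only used for n ≥ 1; value 0 at n = 0 is irrelevant)
oneOver : ℕ → ℚ
oneOver zero = 0ℚ
oneOver (suc n) = + 1 / suc n

ofℕ : ℕ → ℚ
ofℕ x = + x / 1

invFact : ℕ → ℚ
invFact m = ((+ 1) / (m !)) {{m !≢0}}

-- Put a new container on top of a column of n containers whose labels are in
-- uniformly random relative order.  It is blocking unless its label is the
-- smallest of the column, which happens for exactly one of its n + 1 possible
-- relative ranks, and it does not affect the containers below it.  Hence the
-- number c(k, m) of orderings of m containers with k blocking ones satisfies
-- c(k, n + 1) = c(k, n) + n c(k - 1, n) and c(0, m) = 1; unrolling the second
-- term and dividing by (n + 1)! gives the recurrence for p_{k,h} = c(k, h) / h!.
-- The same decomposition shows that the number of blocking containers of a
-- column only depends on the relative order of its labels.  Since permuting the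
-- tiers of one column is a bijection of bays, every column of a uniformly random
-- bay is thus a uniformly random column, and linearity of expectation gives
-- E[S₀] = C Σ_k k p_{k,h} = α_h C.

module Submission where

open import Defs
open import Data.Bool using (Bool; true; false; T; _∧_)
open import Data.Bool.Properties using (T-∧)
open import Data.Empty using (⊥; ⊥-elim)
open import Data.Fin as Fin using (Fin; zero; suc; toℕ; fromℕ; inject₁; punchIn; punchOut; combine; remQuot)
import Data.Fin.Properties as Fin
open import Data.List as List using (List; []; _∷_; map; length; filterᵇ; allFin; upTo; tabulate; cartesianProductWith; _++_)
import Data.List.Properties as List
open import Data.List.Membership.Propositional using (_∈_)
import Data.List.Membership.Propositional.Properties as ∈
open import Data.List.Relation.Binary.BagAndSetEquality using (∼bag⇒↭)
open import Data.List.Membership.Propositional.Properties.WithK using (unique∧set⇒bag)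
open import Data.List.Relation.Binary.Permutation.Propositional using (_↭_)
import Data.List.Relation.Binary.Permutation.Propositional.Properties as ↭
import Data.List.Relation.Unary.All as ListAll
import Data.Vec.Relation.Unary.All.Properties as VecAll
open import Data.List.Relation.Unary.AllPairs using () renaming ([] to []ᵖ; _∷_ to _∷ᵖ_)
open import Data.List.Relation.Unary.Any as Any using (here; there)
import Data.List.Relation.Unary.Any.Properties as Any
open import Data.List.Relation.Unary.Unique.Propositional using (Unique)
import Data.List.Relation.Unary.Unique.Propositional.Properties as Unique
open import Data.Nat as ℕ using (ℕ; zero; suc; _+_; _*_; _∸_; _≤_; _!)
import Data.Nat.Properties as ℕ
open import Algebra.Properties.CommutativeSemigroup ℕ.+-commutativeSemigroup
  using () renaming (interchange to +-interchange)
open import Data.Nat.ListAction.Properties using (sum-↭)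
open import Algebra.Properties.Semiring.Sum ℕ.+-*-semiring
  using (sum; sum-syntax; sum-cong-≗; sum-remove; sum-init-last)
import Data.Integer as ℤ
import Data.Integer.Properties as ℤ
open import Data.Rational as ℚ using (ℚ; _/_)
import Data.Rational.Properties as ℚ
import Data.Rational.Unnormalised as ℚᵘ
import Data.Rational.Unnormalised.Properties as ℚᵘ
import Data.Integer.Tactic.RingSolver as ℤ-Solver
import Data.Nat.Tactic.RingSolver as ℕ-Solver
open import Data.Product as Product using (∃; ∃-syntax; _×_; _,_; proj₁; proj₂)
open import Data.Vec as Vec using (Vec; []; _∷_; lookup; toList; _∷ʳ_)
import Data.Vec.Properties as Vec
open import Function using (_∘_; id; _⇔_; mk⇔; Equivalence)
open import Function.Definitions using (Injective)
import Function.Properties.Equivalence as ⇔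
open import Relation.Binary.PropositionalEquality
open import Relation.Nullary using (¬_; Dec; yes; no; does)
open import Relation.Nullary.Decidable using (T?; does-⇔; dec-true; dec-false)

private variable
  A B D : Set
  n M : ℕ

-- Finite sums

𝟙 : Bool → ℕ
𝟙 true  = 1
𝟙 false = 0

sumOver : List A → (A → ℕ) → ℕ
sumOver xs f = sumℕ (map f xs)

syntax sumOver xs (λ x → e) = ∑[ x ∈ xs ] e

∑∈-cong : (xs : List A) {f g : A → ℕ} → (∀ {x} → x ∈ xs → f x ≡ g x) →
          ∑[ x ∈ xs ] f x ≡ ∑[ x ∈ xs ] g x
∑∈-cong []       eq = refl
∑∈-cong (x ∷ xs) eq = cong₂ _+_ (eq (here refl)) (∑∈-cong xs (eq ∘ there))

∑∈-const : (xs : List A) (c : ℕ) → ∑[ x ∈ xs ] c ≡ length xs * c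
∑∈-const []       c = refl
∑∈-const (x ∷ xs) c = cong (c +_) (∑∈-const xs c)

∑∈-zero : (xs : List A) → ∑[ x ∈ xs ] 0 ≡ 0
∑∈-zero []       = refl
∑∈-zero (x ∷ xs) = ∑∈-zero xs

∑∈-*ˡ : (xs : List A) (c : ℕ) (f : A → ℕ) → ∑[ x ∈ xs ] (c * f x) ≡ c * ∑[ x ∈ xs ] f x
∑∈-*ˡ []       c f = sym (ℕ.*-zeroʳ c)
∑∈-*ˡ (x ∷ xs) c f = trans (cong (c * f x +_) (∑∈-*ˡ xs c f)) (sym (ℕ.*-distribˡ-+ c _ _))

∑∈-distrib-+ : (xs : List A) (f g : A → ℕ) →
               ∑[ x ∈ xs ] (f x + g x) ≡ ∑[ x ∈ xs ] f x + ∑[ x ∈ xs ] g x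
∑∈-distrib-+ []       f g = refl
∑∈-distrib-+ (x ∷ xs) f g = begin
  f x + g x + ∑[ y ∈ xs ] (f y + g y)             ≡⟨ cong (f x + g x +_) (∑∈-distrib-+ xs f g) ⟩
  f x + g x + (∑[ y ∈ xs ] f y + ∑[ y ∈ xs ] g y) ≡⟨ +-interchange (f x) (g x) _ _ ⟩
  f x + ∑[ y ∈ xs ] f y + (g x + ∑[ y ∈ xs ] g y) ∎
  where open ≡-Reasoning

∑∈-comm : (xs : List A) (ys : List B) (f : A → B → ℕ) →
          ∑[ x ∈ xs ] ∑[ y ∈ ys ] f x y ≡ ∑[ y ∈ ys ] ∑[ x ∈ xs ] f x y
∑∈-comm []       ys f = sym (∑∈-zero ys)
∑∈-comm (x ∷ xs) ys f =
  trans (cong (∑[ y ∈ ys ] f x y +_) (∑∈-comm xs ys f)) (sym (∑∈-distrib-+ ys (f x) _))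

∑∈-map : (g : A → B) (xs : List A) (f : B → ℕ) → ∑[ y ∈ map g xs ] f y ≡ ∑[ x ∈ xs ] f (g x)
∑∈-map g xs f = cong sumℕ (sym (List.map-∘ xs))

∑∈-++ : (xs ys : List A) (f : A → ℕ) → ∑[ x ∈ xs ++ ys ] f x ≡ ∑[ x ∈ xs ] f x + ∑[ x ∈ ys ] f x
∑∈-++ []       ys f = refl
∑∈-++ (x ∷ xs) ys f = trans (cong (f x +_) (∑∈-++ xs ys f)) (sym (ℕ.+-assoc (f x) _ _))

∑∈-cartesianProductWith : (g : A → B → D) (xs : List A) (ys : List B) (f : D → ℕ) →
  ∑[ z ∈ cartesianProductWith g xs ys ] f z ≡ ∑[ x ∈ xs ] ∑[ y ∈ ys ] f (g x y)
∑∈-cartesianProductWith g []       ys f = refl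
∑∈-cartesianProductWith g (x ∷ xs) ys f =
  trans (∑∈-++ (map (g x) ys) _ f)
        (cong₂ _+_ (∑∈-map (g x) ys f) (∑∈-cartesianProductWith g xs ys f))

∑∈-↭ : {xs ys : List A} (f : A → ℕ) → xs ↭ ys → ∑[ x ∈ xs ] f x ≡ ∑[ y ∈ ys ] f y
∑∈-↭ f xs↭ys = sum-↭ (↭.map⁺ f xs↭ys)

∑∈-allFin : (f : Fin n → ℕ) → ∑[ i ∈ allFin n ] f i ≡ ∑[ i < n ] f i
∑∈-allFin {zero}  f = refl
∑∈-allFin {suc n} f = cong (f zero +_) (begin
  sumℕ (map f (tabulate suc))              ≡⟨ cong sumℕ (List.map-tabulate suc f) ⟩
  sumℕ (tabulate (f ∘ suc))                ≡⟨ cong sumℕ (List.map-tabulate id (f ∘ suc)) ⟨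
  ∑[ i ∈ allFin n ] f (suc i)              ≡⟨ ∑∈-allFin (f ∘ suc) ⟩
  ∑[ i < n ] f (suc i)                     ∎)
  where open ≡-Reasoning

∑∈-upTo-suc : (k : ℕ) (f : ℕ → ℕ) → ∑[ i ∈ upTo (suc k) ] f i ≡ f 0 + ∑[ i ∈ upTo k ] f (suc i)
∑∈-upTo-suc k f = cong (f 0 +_) (trans (cong (sumℕ ∘ map f) (sym (List.map-applyUpTo id suc k))) (∑∈-map suc (upTo k) f))

length-filterᵇ : (p : A → Bool) (xs : List A) → length (filterᵇ p xs) ≡ ∑[ x ∈ xs ] 𝟙 (p x)
length-filterᵇ p []       = refl
length-filterᵇ p (x ∷ xs) with p x
... | true  = cong suc (length-filterᵇ p xs)
... | false = length-filterᵇ p xs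

∑-const : (n c : ℕ) → ∑[ i < n ] c ≡ n * c
∑-const zero    c = refl
∑-const (suc n) c = cong (c +_) (∑-const n c)

-- Permutations

lookup-injective⇒Unique : (v : Vec A n) → Injective _≡_ _≡_ (lookup v) → Unique (toList v)
lookup-injective⇒Unique []      inj = []ᵖ
lookup-injective⇒Unique (x ∷ v) inj =
  VecAll.toList⁺ (VecAll.lookup⁻ (λ j → Fin.0≢1+n ∘ inj)) ∷ᵖ lookup-injective⇒Unique v (Fin.suc-injective ∘ inj)

Unique⇒lookup-injective : (v : Vec A n) → Unique (toList v) → Injective _≡_ _≡_ (lookup v)
Unique⇒lookup-injective (x ∷ v) (x∉v ∷ᵖ u) {zero}  {zero}  _  = refl
Unique⇒lookup-injective (x ∷ v) (x∉v ∷ᵖ u) {zero}  {suc j} eq = ⊥-elim (VecAll.lookup⁺ (VecAll.toList⁻ x∉v) j eq)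
Unique⇒lookup-injective (x ∷ v) (x∉v ∷ᵖ u) {suc i} {zero}  eq = ⊥-elim (VecAll.lookup⁺ (VecAll.toList⁻ x∉v) i (sym eq))
Unique⇒lookup-injective (x ∷ v) (x∉v ∷ᵖ u) {suc i} {suc j} eq = cong suc (Unique⇒lookup-injective v u eq)

concatMap-map≡cartesianProductWith : (g : A → B → D) (xs : List A) (ys : List B) →
  List.concatMap (λ x → map (g x) ys) xs ≡ cartesianProductWith g xs ys
concatMap-map≡cartesianProductWith g []       ys = refl
concatMap-map≡cartesianProductWith g (x ∷ xs) ys =
  cong (map (g x) ys ++_) (concatMap-map≡cartesianProductWith g xs ys)

allVecs-suc : ∀ k → allVecs {n} (suc k) ≡ cartesianProductWith _∷_ (allFin n) (allVecs k)
allVecs-suc {n} k = concatMap-map≡cartesianProductWith _∷_ (allFin n) (allVecs k)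

∈-allVecs : ∀ {k} (v : Vec (Fin n) k) → v ∈ allVecs k
∈-allVecs []      = here refl
∈-allVecs (x ∷ v) = subst (_ ∈_) (sym (allVecs-suc _))
  (∈.∈-cartesianProductWith⁺ _∷_ (∈.∈-allFin x) (∈-allVecs v))

perms-unique : ∀ n → Unique (perms n)
perms-unique n = Unique.filter⁺ _ (allVecs-unique n)
  where
  allVecs-unique : ∀ k → Unique (allVecs {n} k)
  allVecs-unique zero    = ListAll.[] ∷ᵖ []ᵖ
  allVecs-unique (suc k) = subst Unique (sym (allVecs-suc k))
    (Unique.cartesianProductWith⁺ _∷_ Vec.∷-injective (Unique.allFin⁺ n) (allVecs-unique k))

∈-perms⁻ : {σ : Vec (Fin n) n} → σ ∈ perms n → Injective _≡_ _≡_ (lookup σ)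
∈-perms⁻ {n} {σ} σ∈ = Unique⇒lookup-injective σ (proj₂ (∈.∈-filter⁻ _ {xs = allVecs n} σ∈))

∈-perms⁺ : (σ : Vec (Fin n) n) → Injective _≡_ _≡_ (lookup σ) → σ ∈ perms n
∈-perms⁺ σ inj = ∈.∈-filter⁺ _ (∈-allVecs σ) (lookup-injective⇒Unique σ inj)

↭-perms : {xs : List (Vec (Fin n) n)} → Unique xs →
  (∀ {σ} → σ ∈ xs → Injective _≡_ _≡_ (lookup σ)) →
  (∀ σ → Injective _≡_ _≡_ (lookup σ) → σ ∈ xs) → xs ↭ perms n
↭-perms {n} u sound complete = ∼bag⇒↭ (unique∧set⇒bag u (perms-unique n)
  (mk⇔ (λ σ∈ → ∈-perms⁺ _ (sound σ∈)) (λ σ∈ → complete _ (∈-perms⁻ σ∈))))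

injective⇒surjective : (f : Fin n → Fin n) → Injective _≡_ _≡_ f → ∀ y → ∃[ x ] f x ≡ y
injective⇒surjective {zero}  f inj ()
injective⇒surjective {suc n} f inj y with Fin.any? (λ x → f x Fin.≟ y)
... | yes found = found
... | no  ¬found = ⊥-elim (ℕ.<-irrefl refl (Fin.injective⇒≤ (punchOut-f-injective)))
  where
  f≢y : ∀ x → f x ≢ y
  f≢y x eq = ¬found (x , eq)
  punchOut-f-injective : Injective _≡_ _≡_ (λ x → punchOut (f≢y x ∘ sym))
  punchOut-f-injective eq = inj (Fin.punchOut-injective (f≢y _ ∘ sym) (f≢y _ ∘ sym) eq)

lookup-ext : (u v : Vec A n) → (∀ i → lookup u i ≡ lookup v i) → u ≡ v
lookup-ext u v eq = trans (sym (Vec.tabulate∘lookup u)) (trans (Vec.tabulate-cong eq) (Vec.tabulate∘lookup v))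

data TopView : Fin (suc n) → Set where
  top   : TopView (fromℕ n)
  below : (s : Fin n) → TopView (inject₁ s)

topView : (t : Fin (suc n)) → TopView t
topView {zero}  zero    = top
topView {suc n} zero    = below zero
topView {suc n} (suc t) with topView t
... | top     = top
... | below s = below (suc s)

lookup-∷ʳ-last : (xs : Vec A n) (x : A) → lookup (xs ∷ʳ x) (fromℕ n) ≡ x
lookup-∷ʳ-last []       x = refl
lookup-∷ʳ-last (y ∷ xs) x = lookup-∷ʳ-last xs x

lookup-∷ʳ-inject₁ : (xs : Vec A n) (x : A) (i : Fin n) → lookup (xs ∷ʳ x) (inject₁ i) ≡ lookup xs i
lookup-∷ʳ-inject₁ (y ∷ xs) x zero    = refl
lookup-∷ʳ-inject₁ (y ∷ xs) x (suc i) = lookup-∷ʳ-inject₁ xs x i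

insertTop : Fin (suc n) → Vec (Fin n) n → Vec (Fin (suc n)) (suc n)
insertTop v σ = Vec.map (punchIn v) σ ∷ʳ v

lookup-insertTop-top : (v : Fin (suc n)) (σ : Vec (Fin n) n) → lookup (insertTop v σ) (fromℕ n) ≡ v
lookup-insertTop-top v σ = lookup-∷ʳ-last (Vec.map (punchIn v) σ) v

lookup-insertTop-below : (v : Fin (suc n)) (σ : Vec (Fin n) n) (s : Fin n) →
  lookup (insertTop v σ) (inject₁ s) ≡ punchIn v (lookup σ s)
lookup-insertTop-below v σ s =
  trans (lookup-∷ʳ-inject₁ (Vec.map (punchIn v) σ) v s) (Vec.lookup-map s (punchIn v) σ)

insertTop-lookup-injective : (v : Fin (suc n)) (σ : Vec (Fin n) n) →
  Injective _≡_ _≡_ (lookup σ) → Injective _≡_ _≡_ (lookup (insertTop v σ))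
insertTop-lookup-injective v σ inj {t} {t'} eq with topView t | topView t'
... | top     | top      = refl
... | top     | below s' = ⊥-elim (Fin.punchInᵢ≢i v (lookup σ s')
        (sym (trans (sym (lookup-insertTop-top v σ)) (trans eq (lookup-insertTop-below v σ s')))))
... | below s | top      = ⊥-elim (Fin.punchInᵢ≢i v (lookup σ s)
        (trans (sym (lookup-insertTop-below v σ s)) (trans eq (lookup-insertTop-top v σ))))
... | below s | below s' = cong inject₁ (inj (Fin.punchIn-injective v _ _
        (trans (sym (lookup-insertTop-below v σ s)) (trans eq (lookup-insertTop-below v σ s')))))

insertTop-injective : {v v' : Fin (suc n)} {σ σ' : Vec (Fin n) n} →
  insertTop v σ ≡ insertTop v' σ' → v ≡ v' × σ ≡ σ'
insertTop-injective {v = v} {σ = σ} {σ'} eq with Vec.∷ʳ-injective (Vec.map (punchIn v) σ) _ eq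
... | below≡ , refl = refl , lookup-ext σ σ' λ i → Fin.punchIn-injective v _ _ (begin
  punchIn v (lookup σ i)               ≡⟨ Vec.lookup-map i (punchIn v) σ ⟨
  lookup (Vec.map (punchIn v) σ) i     ≡⟨ cong (λ w → lookup w i) below≡ ⟩
  lookup (Vec.map (punchIn v) σ') i    ≡⟨ Vec.lookup-map i (punchIn v) σ' ⟩
  punchIn v (lookup σ' i)              ∎)
  where open ≡-Reasoning

removeTop : (π : Vec (Fin (suc n)) (suc n)) → Injective _≡_ _≡_ (lookup π) →
  ∃[ σ ] Injective _≡_ _≡_ (lookup σ) × insertTop (lookup π (fromℕ n)) σ ≡ π
removeTop {n} π inj = σ , σ-injective , lookup-ext _ π insert-remove
  where
  v = lookup π (fromℕ n)
  v≢ : ∀ s → v ≢ lookup π (inject₁ s)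
  v≢ s = Fin.fromℕ≢inject₁ ∘ inj
  σ = Vec.tabulate (λ s → punchOut (v≢ s))
  lookup-σ : ∀ s → lookup σ s ≡ punchOut (v≢ s)
  lookup-σ = Vec.lookup∘tabulate (λ s → punchOut (v≢ s))
  σ-injective : Injective _≡_ _≡_ (lookup σ)
  σ-injective {s} {s'} eq = Fin.inject₁-injective (inj
    (Fin.punchOut-injective (v≢ s) (v≢ s') (trans (sym (lookup-σ s)) (trans eq (lookup-σ s')))))
  insert-remove : ∀ t → lookup (insertTop v σ) t ≡ lookup π t
  insert-remove t with topView t
  ... | top     = lookup-insertTop-top v σ
  ... | below s = trans (lookup-insertTop-below v σ s)
                    (trans (cong (punchIn v) (lookup-σ s)) (Fin.punchIn-punchOut (v≢ s)))

∑-perms-suc : (G : Vec (Fin (suc n)) (suc n) → ℕ) →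
  ∑[ π ∈ perms (suc n) ] G π ≡ ∑[ v < suc n ] ∑[ σ ∈ perms n ] G (insertTop v σ)
∑-perms-suc {n} G = begin
  ∑[ π ∈ perms (suc n) ] G π                              ≡⟨ ∑∈-↭ G decomposition ⟨
  ∑[ π ∈ cartesianProductWith insertTop (allFin (suc n)) (perms n) ] G π
    ≡⟨ ∑∈-cartesianProductWith insertTop (allFin (suc n)) (perms n) G ⟩
  ∑[ v ∈ allFin (suc n) ] ∑[ σ ∈ perms n ] G (insertTop v σ) ≡⟨ ∑∈-allFin (λ v → ∑[ σ ∈ perms n ] G (insertTop v σ)) ⟩
  ∑[ v < suc n ] ∑[ σ ∈ perms n ] G (insertTop v σ)        ∎
  where
  open ≡-Reasoning
  decomposition : cartesianProductWith insertTop (allFin (suc n)) (perms n) ↭ perms (suc n)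
  decomposition = ↭-perms
    (Unique.cartesianProductWith⁺ insertTop insertTop-injective (Unique.allFin⁺ (suc n)) (perms-unique n))
    (λ π∈ → let v , σ , _ , σ∈ , π≡ = ∈.∈-cartesianProductWith⁻ insertTop (allFin (suc n)) (perms n) π∈
            in subst (λ π → Injective _≡_ _≡_ (lookup π)) (sym π≡) (insertTop-lookup-injective v σ (∈-perms⁻ σ∈)))
    (λ π inj → let σ , σ-inj , π≡ = removeTop π inj
               in subst (_∈ _) π≡ (∈.∈-cartesianProductWith⁺ insertTop (∈.∈-allFin _) (∈-perms⁺ σ σ-inj)))

∑∈-perms-1 : ∀ n → ∑[ π ∈ perms n ] 1 ≡ n !
∑∈-perms-1 zero    = refl
∑∈-perms-1 (suc n) = begin
  ∑[ π ∈ perms (suc n) ] 1                ≡⟨ ∑-perms-suc {n} (λ _ → 1) ⟩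
  ∑[ v < suc n ] ∑[ σ ∈ perms n ] 1       ≡⟨ ∑-const (suc n) _ ⟩
  suc n * ∑[ σ ∈ perms n ] 1              ≡⟨ cong (suc n *_) (∑∈-perms-1 n) ⟩
  suc n !                                 ∎
  where open ≡-Reasoning

length-perms : ∀ n → length (perms n) ≡ n !
length-perms n = trans (sym (ℕ.*-identityʳ _)) (trans (sym (∑∈-const (perms n) 1)) (∑∈-perms-1 n))

reindex : (Fin n → Fin n) → Vec A n → Vec A n
reindex ρ π = Vec.tabulate (lookup π ∘ ρ)

lookup-reindex : (ρ : Fin n → Fin n) (π : Vec A n) (i : Fin n) → lookup (reindex ρ π) i ≡ lookup π (ρ i)
lookup-reindex ρ π = Vec.lookup∘tabulate (lookup π ∘ ρ)

reindex-lookup-injective : (ρ : Fin n → Fin n) (π : Vec A n) → Injective _≡_ _≡_ ρ → Injective _≡_ _≡_ (lookup π) →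
                           Injective _≡_ _≡_ (lookup (reindex ρ π))
reindex-lookup-injective ρ π ρ-inj π-inj {i} {j} eq =
  ρ-inj (π-inj (trans (sym (lookup-reindex ρ π i)) (trans eq (lookup-reindex ρ π j))))

∑-perms-reindex : (ρ : Fin n → Fin n) → Injective _≡_ _≡_ ρ → (G : Vec (Fin n) n → ℕ) →
  ∑[ π ∈ perms n ] G (reindex ρ π) ≡ ∑[ π ∈ perms n ] G π
∑-perms-reindex {n} ρ ρ-inj G = trans (sym (∑∈-map (reindex ρ) (perms n) G)) (∑∈-↭ G reindexing)
  where
  ρ⁻¹ : Fin n → Fin n
  ρ⁻¹ = proj₁ ∘ injective⇒surjective ρ ρ-inj
  ρ∘ρ⁻¹ : ∀ i → ρ (ρ⁻¹ i) ≡ i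
  ρ∘ρ⁻¹ = proj₂ ∘ injective⇒surjective ρ ρ-inj
  ρ⁻¹∘ρ : ∀ i → ρ⁻¹ (ρ i) ≡ i
  ρ⁻¹∘ρ i = ρ-inj (ρ∘ρ⁻¹ (ρ i))
  ρ⁻¹-injective : Injective _≡_ _≡_ ρ⁻¹
  ρ⁻¹-injective {i} {j} eq = trans (sym (ρ∘ρ⁻¹ i)) (trans (cong ρ eq) (ρ∘ρ⁻¹ j))
  reindex-inverse : ∀ {τ τ' : Fin n → Fin n} → (∀ i → τ (τ' i) ≡ i) →
                    (π : Vec (Fin n) n) → reindex τ' (reindex τ π) ≡ π
  reindex-inverse {τ} {τ'} ττ' π = lookup-ext _ π λ i →
    trans (lookup-reindex τ' (reindex τ π) i) (trans (lookup-reindex τ π (τ' i)) (cong (lookup π) (ττ' i)))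
  reindexing : map (reindex ρ) (perms n) ↭ perms n
  reindexing = ↭-perms
    (Unique.map⁺ (λ {π} {π'} eq → trans (sym (reindex-inverse ρ∘ρ⁻¹ π))
                                        (trans (cong (reindex ρ⁻¹) eq) (reindex-inverse ρ∘ρ⁻¹ π')))
                 (perms-unique n))
    (λ π∈ → let π , π∈ , eq = ∈.∈-map⁻ (reindex ρ) π∈ in
            subst (λ σ → Injective _≡_ _≡_ (lookup σ)) (sym eq) (reindex-lookup-injective ρ π ρ-inj (∈-perms⁻ π∈)))
    (λ π π-inj → subst (_∈ _) (reindex-inverse ρ⁻¹∘ρ π)
      (∈.∈-map⁺ (reindex ρ) (∈-perms⁺ (reindex ρ⁻¹ π) (reindex-lookup-injective ρ⁻¹ π ρ⁻¹-injective π-inj))))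

-- Blocking containers

Blocks : {h : ℕ} → (Fin h → Fin M) → Fin h → Set
Blocks f t = ∃[ t' ] t' Fin.< t × f t' Fin.< f t

T-isBlocking : {h : ℕ} (f : Fin h → Fin M) (t : Fin h) → T (isBlocking f t) ⇔ Blocks f t
T-isBlocking {h = h} f t = mk⇔ to from
  where
  below-and-smaller : Fin h → Bool
  below-and-smaller t' = (toℕ t' ℕ.<ᵇ toℕ t) ∧ (toℕ (f t') ℕ.<ᵇ toℕ (f t))
  to : T (isBlocking f t) → Blocks f t
  to b with t' , b' ← Any.satisfied (Any.any⁻ below-and-smaller (allFin h) b) =
    let lt , flt = Equivalence.to T-∧ b' in t' , ℕ.<ᵇ⇒< _ _ lt , ℕ.<ᵇ⇒< _ _ flt
  from : Blocks f t → T (isBlocking f t)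
  from (t' , lt , flt) = Any.any⁺ below-and-smaller
    (Any.map (λ { refl → Equivalence.from T-∧ (ℕ.<⇒<ᵇ lt , ℕ.<⇒<ᵇ flt) }) (∈.∈-allFin t'))

isBlocking≡does : {h : ℕ} (f : Fin h → Fin M) (t : Fin h) {P : Set} (P? : Dec P) →
                  Blocks f t ⇔ P → isBlocking f t ≡ does P?
isBlocking≡does f t P? B⇔P = does-⇔ (⇔.trans (T-isBlocking f t) B⇔P) (T? (isBlocking f t)) P?

isBlocking-cong : {h h' : ℕ} (f : Fin h → Fin M) (t : Fin h) (g : Fin h' → Fin M) (s : Fin h') →
                  Blocks f t ⇔ Blocks g s → isBlocking f t ≡ isBlocking g s
isBlocking-cong f t g s B⇔B = isBlocking≡does f t (T? (isBlocking g s)) (⇔.trans B⇔B (⇔.sym (T-isBlocking g s)))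

blockingInColumn≡∑ : {h : ℕ} (f : Fin h → Fin M) → blockingInColumn f ≡ ∑[ t < h ] 𝟙 (isBlocking f t)
blockingInColumn≡∑ {h = h} f = trans (length-filterᵇ (isBlocking f) (allFin h)) (∑∈-allFin (𝟙 ∘ isBlocking f))

blockingInColumn-cong : {h : ℕ} {f g : Fin h → Fin M} → (∀ t → f t ≡ g t) →
                        blockingInColumn f ≡ blockingInColumn g
blockingInColumn-cong {f = f} {g} f≗g = begin
  blockingInColumn f                   ≡⟨ blockingInColumn≡∑ f ⟩
  ∑[ t < _ ] 𝟙 (isBlocking f t)        ≡⟨ sum-cong-≗ (λ t → cong 𝟙 (isBlocking-cong f t g t (mk⇔ (Blocks-≗ f≗g) (Blocks-≗ (sym ∘ f≗g))))) ⟩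
  ∑[ t < _ ] 𝟙 (isBlocking g t)        ≡⟨ blockingInColumn≡∑ g ⟨
  blockingInColumn g                   ∎
  where
  open ≡-Reasoning
  Blocks-≗ : ∀ {f g : Fin _ → Fin _} {t} → (∀ t → f t ≡ g t) → Blocks f t → Blocks g t
  Blocks-≗ {t = t} f≗g (t' , lt , flt) = t' , lt , subst₂ Fin._<_ (f≗g t') (f≗g t) flt

inject₁-<⁻ : {i j : Fin n} → inject₁ i Fin.< inject₁ j → i Fin.< j
inject₁-<⁻ {i = i} {j} = subst₂ ℕ._<_ (Fin.toℕ-inject₁ i) (Fin.toℕ-inject₁ j)

inject₁-<⁺ : {i j : Fin n} → i Fin.< j → inject₁ i Fin.< inject₁ j
inject₁-<⁺ {i = i} {j} = subst₂ ℕ._<_ (sym (Fin.toℕ-inject₁ i)) (sym (Fin.toℕ-inject₁ j))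

inject₁<fromℕ : (i : Fin n) → inject₁ i Fin.< fromℕ n
inject₁<fromℕ {n} i = subst₂ ℕ._<_ (sym (Fin.toℕ-inject₁ i)) (sym (Fin.toℕ-fromℕ n)) (Fin.toℕ<n i)

fromℕ≮inject₁ : (i : Fin n) → ¬ fromℕ n Fin.< inject₁ i
fromℕ≮inject₁ i lt = ℕ.<-asym lt (inject₁<fromℕ i)

Blocks-inject₁ : (f : Fin (suc n) → Fin M) (s : Fin n) → Blocks f (inject₁ s) ⇔ Blocks (f ∘ inject₁) s
Blocks-inject₁ f s = mk⇔ to (λ (u , lt , flt) → inject₁ u , inject₁-<⁺ lt , flt)
  where
  to : Blocks f (inject₁ s) → Blocks (f ∘ inject₁) s
  to (t' , lt , flt) with topView t'
  ... | top     = ⊥-elim (fromℕ≮inject₁ s lt)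
  ... | below u = u , inject₁-<⁻ lt , flt

Blocks-fromℕ : (f : Fin (suc n) → Fin M) → Blocks f (fromℕ n) ⇔ (∃[ s ] f (inject₁ s) Fin.< f (fromℕ n))
Blocks-fromℕ {n} f = mk⇔ to (λ (s , flt) → inject₁ s , inject₁<fromℕ s , flt)
  where
  to : Blocks f (fromℕ n) → ∃[ s ] f (inject₁ s) Fin.< f (fromℕ n)
  to (t' , lt , flt) with topView t'
  ... | top     = ⊥-elim (ℕ.<-irrefl refl lt)
  ... | below u = u , flt

blockingInColumn-init-last : (f : Fin (suc n) → Fin M) →
  blockingInColumn f ≡ blockingInColumn (f ∘ inject₁) + 𝟙 (isBlocking f (fromℕ n))
blockingInColumn-init-last {n} f = begin
  blockingInColumn f                                                           ≡⟨ blockingInColumn≡∑ f ⟩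
  ∑[ t < suc n ] 𝟙 (isBlocking f t)                                            ≡⟨ sum-init-last (𝟙 ∘ isBlocking f) ⟩
  ∑[ s < n ] 𝟙 (isBlocking f (inject₁ s)) + 𝟙 (isBlocking f (fromℕ n))
    ≡⟨ cong₂ _+_ (sum-cong-≗ λ s → cong 𝟙 (isBlocking-cong f (inject₁ s) (f ∘ inject₁) s (Blocks-inject₁ f s))) refl ⟩
  ∑[ s < n ] 𝟙 (isBlocking (f ∘ inject₁) s) + 𝟙 (isBlocking f (fromℕ n))       ≡⟨ cong₂ _+_ (blockingInColumn≡∑ (f ∘ inject₁)) refl ⟨
  blockingInColumn (f ∘ inject₁) + 𝟙 (isBlocking f (fromℕ n))                  ∎
  where open ≡-Reasoning

∑-𝟙≤ : ∀ n (b : Fin n → Bool) → ∑[ i < n ] 𝟙 (b i) ≤ n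
∑-𝟙≤ zero    b = ℕ.z≤n
∑-𝟙≤ (suc n) b = ℕ.+-mono-≤ (𝟙≤1 (b zero)) (∑-𝟙≤ n (b ∘ suc))
  where
  𝟙≤1 : ∀ x → 𝟙 x ≤ 1
  𝟙≤1 true  = ℕ.≤-refl
  𝟙≤1 false = ℕ.z≤n

blockingInColumn≤ : {h : ℕ} (f : Fin h → Fin M) → blockingInColumn f ≤ h ∸ 1
blockingInColumn≤ {h = zero}  f = ℕ.z≤n
blockingInColumn≤ {h = suc n} f =
  subst (_≤ n) (sym (trans (blockingInColumn≡∑ f) (cong₂ _+_ (cong 𝟙 bottom-not-blocking) refl)))
        (∑-𝟙≤ n (isBlocking f ∘ suc))
  where
  bottom-not-blocking : isBlocking f zero ≡ false
  bottom-not-blocking = isBlocking≡does f zero {⊥} (no λ ()) (mk⇔ (λ { (_ , () , _) }) λ ())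

NotMinimal : (g : Fin (suc n) → Fin M) → Fin (suc n) → Set
NotMinimal g v = ∃[ u ] g (punchIn v u) Fin.< g v

notMinimal? : (g : Fin (suc n) → Fin M) (v : Fin (suc n)) → Dec (NotMinimal g v)
notMinimal? g v = Fin.any? (λ u → g (punchIn v u) Fin.<? g v)

blockingInColumn-insertTop : (g : Fin (suc n) → Fin M) (v : Fin (suc n)) (σ : Vec (Fin n) n) →
  Injective _≡_ _≡_ (lookup σ) →
  blockingInColumn (g ∘ lookup (insertTop v σ)) ≡
  𝟙 (does (notMinimal? g v)) + blockingInColumn (g ∘ punchIn v ∘ lookup σ)
blockingInColumn-insertTop {n} g v σ σ-inj = begin
  blockingInColumn f                                                  ≡⟨ blockingInColumn-init-last f ⟩
  blockingInColumn (f ∘ inject₁) + 𝟙 (isBlocking f (fromℕ n))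
    ≡⟨ cong₂ _+_ (blockingInColumn-cong (cong g ∘ lookup-insertTop-below v σ)) (cong 𝟙 top-blocking) ⟩
  blockingInColumn (g ∘ punchIn v ∘ lookup σ) + 𝟙 (does (notMinimal? g v)) ≡⟨ ℕ.+-comm (blockingInColumn (g ∘ punchIn v ∘ lookup σ)) _ ⟩
  𝟙 (does (notMinimal? g v)) + blockingInColumn (g ∘ punchIn v ∘ lookup σ) ∎
  where
  open ≡-Reasoning
  f = g ∘ lookup (insertTop v σ)
  below-top : ∀ s → g (punchIn v (lookup σ s)) Fin.< g v → f (inject₁ s) Fin.< f (fromℕ n)
  below-top s = subst₂ Fin._<_ (sym (cong g (lookup-insertTop-below v σ s))) (sym (cong g (lookup-insertTop-top v σ)))
  top-below : ∀ s → f (inject₁ s) Fin.< f (fromℕ n) → g (punchIn v (lookup σ s)) Fin.< g v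
  top-below s = subst₂ Fin._<_ (cong g (lookup-insertTop-below v σ s)) (cong g (lookup-insertTop-top v σ))
  -- σ is onto, so the labels below the top are exactly the labels other than v.
  smaller-below⇔NotMinimal : (∃[ s ] f (inject₁ s) Fin.< f (fromℕ n)) ⇔ NotMinimal g v
  smaller-below⇔NotMinimal = mk⇔ (λ (s , lt) → lookup σ s , top-below s lt)
    λ (u , lt) → let s , σs≡u = injective⇒surjective (lookup σ) σ-inj u
                 in s , below-top s (subst (λ w → g (punchIn v w) Fin.< g v) (sym σs≡u) lt)
  top-blocking : isBlocking f (fromℕ n) ≡ does (notMinimal? g v)
  top-blocking = isBlocking≡does f (fromℕ n) (notMinimal? g v) (⇔.trans (Blocks-fromℕ f) smaller-below⇔NotMinimal)

argmin : (f : Fin (suc n) → ℕ) → ∃[ x ] ∀ y → f x ≤ f y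
argmin {zero}  f = zero , λ { zero → ℕ.≤-refl }
argmin {suc n} f with x , min ← argmin (f ∘ suc) | f zero ℕ.≤? f (suc x)
... | yes f0≤ = zero  , λ { zero → ℕ.≤-refl ; (suc y) → ℕ.≤-trans f0≤ (min y) }
... | no  f0≰ = suc x , λ { zero → ℕ.<⇒≤ (ℕ.≰⇒> f0≰) ; (suc y) → min y }

unique-minimum : (g : Fin (suc n) → Fin M) → Injective _≡_ _≡_ g →
  ∃[ x ] ¬ NotMinimal g x × (∀ u → NotMinimal g (punchIn x u))
unique-minimum g g-inj with x , min ← argmin (toℕ ∘ g) =
  x , (λ (u , lt) → ℕ.<⇒≱ lt (min (punchIn x u))) , λ u →
    punchOut (Fin.punchInᵢ≢i x u) ,
    subst (λ w → g w Fin.< g (punchIn x u)) (sym (Fin.punchIn-punchOut (Fin.punchInᵢ≢i x u)))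
      (ℕ.≤∧≢⇒< (min (punchIn x u)) (Fin.punchInᵢ≢i x u ∘ sym ∘ g-inj ∘ Fin.toℕ-injective))

∑-single-false : (F : Bool → ℕ) (b : Fin (suc n) → Bool) (x : Fin (suc n)) →
  b x ≡ false → (∀ u → b (punchIn x u) ≡ true) → ∑[ v < suc n ] F (b v) ≡ F false + n * F true
∑-single-false {n} F b x bx≡false others≡true = begin
  ∑[ v < suc n ] F (b v)                    ≡⟨ sum-remove {i = x} (F ∘ b) ⟩
  F (b x) + ∑[ u < n ] F (b (punchIn x u))  ≡⟨ cong₂ _+_ (cong F bx≡false) (sum-cong-≗ (cong F ∘ others≡true)) ⟩
  F false + ∑[ u < n ] F true               ≡⟨ cong (F false +_) (∑-const n (F true)) ⟩
  F false + n * F true                      ∎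
  where open ≡-Reasoning

∑-perms-blocking-relabel : ∀ n (g : Fin n → Fin M) → Injective _≡_ _≡_ g → (G : ℕ → ℕ) →
  ∑[ σ ∈ perms n ] G (blockingInColumn (g ∘ lookup σ)) ≡ ∑[ σ ∈ perms n ] G (blockingInColumn (lookup σ))

∑-perms-suc-blocking : ∀ n (g : Fin (suc n) → Fin M) → Injective _≡_ _≡_ g → (G : ℕ → ℕ) →
  ∑[ π ∈ perms (suc n) ] G (blockingInColumn (g ∘ lookup π)) ≡
  ∑[ σ ∈ perms n ] G (blockingInColumn (lookup σ)) + n * ∑[ σ ∈ perms n ] G (suc (blockingInColumn (lookup σ)))
∑-perms-suc-blocking n g g-inj G with x , x-min , others ← unique-minimum g g-inj = begin
  ∑[ π ∈ perms (suc n) ] G (blockingInColumn (g ∘ lookup π))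
    ≡⟨ ∑-perms-suc {n} (G ∘ blockingInColumn ∘ (g ∘_) ∘ lookup) ⟩
  ∑[ v < suc n ] ∑[ σ ∈ perms n ] G (blockingInColumn (g ∘ lookup (insertTop v σ)))
    ≡⟨ sum-cong-≗ {x = λ v → ∑[ σ ∈ perms n ] G (blockingInColumn (g ∘ lookup (insertTop v σ)))}
                  {y = F ∘ does ∘ notMinimal? g} top-at-v ⟩
  ∑[ v < suc n ] F (does (notMinimal? g v))
    ≡⟨ ∑-single-false F (does ∘ notMinimal? g) x (dec-false (notMinimal? g x) x-min)
                      (λ u → dec-true (notMinimal? g (punchIn x u)) (others u)) ⟩
  F false + n * F true ∎
  where
  open ≡-Reasoning
  F : Bool → ℕ
  F b = ∑[ σ ∈ perms n ] G (𝟙 b + blockingInColumn (lookup σ))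
  top-at-v : ∀ v → ∑[ σ ∈ perms n ] G (blockingInColumn (g ∘ lookup (insertTop v σ))) ≡ F (does (notMinimal? g v))
  top-at-v v = trans (∑∈-cong (perms n) λ {σ} σ∈ → cong G (blockingInColumn-insertTop g v σ (∈-perms⁻ σ∈)))
                     (∑-perms-blocking-relabel n (g ∘ punchIn v) (Fin.punchIn-injective v _ _ ∘ g-inj)
                                               (G ∘ (𝟙 (does (notMinimal? g v)) +_)))

∑-perms-blocking-relabel zero    g g-inj G = refl
∑-perms-blocking-relabel (suc n) g g-inj G =
  trans (∑-perms-suc-blocking n g g-inj G) (sym (∑-perms-suc-blocking n id id G))

-- Counting columns by their number of blocking containers

orderingsWithBlocking : (k m : ℕ) → ℕ
orderingsWithBlocking k m = length (filterᵇ (λ σ → blockingInColumn (lookup σ) ℕ.≡ᵇ k) (perms m))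

orderingsWithBlocking≡∑ : ∀ k m → orderingsWithBlocking k m ≡ ∑[ σ ∈ perms m ] 𝟙 (blockingInColumn (lookup σ) ℕ.≡ᵇ k)
orderingsWithBlocking≡∑ k m = length-filterᵇ _ (perms m)

orderingsWithBlocking-suc : ∀ n k →
  orderingsWithBlocking k (suc n) ≡
  orderingsWithBlocking k n + n * ∑[ σ ∈ perms n ] 𝟙 (suc (blockingInColumn (lookup σ)) ℕ.≡ᵇ k)
orderingsWithBlocking-suc n k = begin
  orderingsWithBlocking k (suc n)                                   ≡⟨ orderingsWithBlocking≡∑ k (suc n) ⟩
  ∑[ π ∈ perms (suc n) ] 𝟙 (blockingInColumn (lookup π) ℕ.≡ᵇ k)      ≡⟨ ∑-perms-suc-blocking n id id (λ b → 𝟙 (b ℕ.≡ᵇ k)) ⟩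
  ∑[ σ ∈ perms n ] 𝟙 (blockingInColumn (lookup σ) ℕ.≡ᵇ k) + _        ≡⟨ cong₂ _+_ (orderingsWithBlocking≡∑ k n) refl ⟨
  orderingsWithBlocking k n + n * ∑[ σ ∈ perms n ] 𝟙 (suc (blockingInColumn (lookup σ)) ℕ.≡ᵇ k) ∎
  where open ≡-Reasoning

orderingsWithBlocking-suc-zero : ∀ n → orderingsWithBlocking 0 (suc n) ≡ orderingsWithBlocking 0 n
orderingsWithBlocking-suc-zero n = begin
  orderingsWithBlocking 0 (suc n)                    ≡⟨ orderingsWithBlocking-suc n 0 ⟩
  orderingsWithBlocking 0 n + n * ∑[ σ ∈ perms n ] 0 ≡⟨ cong (λ s → orderingsWithBlocking 0 n + n * s) (∑∈-zero (perms n)) ⟩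
  orderingsWithBlocking 0 n + n * 0                  ≡⟨ cong (orderingsWithBlocking 0 n +_) (ℕ.*-zeroʳ n) ⟩
  orderingsWithBlocking 0 n + 0                      ≡⟨ ℕ.+-identityʳ _ ⟩
  orderingsWithBlocking 0 n                          ∎
  where open ≡-Reasoning

orderingsWithBlocking-suc-suc : ∀ n k →
  orderingsWithBlocking (suc k) (suc n) ≡ orderingsWithBlocking (suc k) n + n * orderingsWithBlocking k n
orderingsWithBlocking-suc-suc n k =
  trans (orderingsWithBlocking-suc n (suc k)) (cong (orderingsWithBlocking (suc k) n +_) (cong (n *_) (sym (orderingsWithBlocking≡∑ k n))))

orderingsWithBlocking-zero : ∀ m → orderingsWithBlocking 0 m ≡ 1
orderingsWithBlocking-zero zero    = refl
orderingsWithBlocking-zero (suc m) = trans (orderingsWithBlocking-suc-zero m) (orderingsWithBlocking-zero m)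

infixl 7 _↓_

_↓_ : ℕ → ℕ → ℕ
n     ↓ zero  = 1
zero  ↓ suc i = 0
suc n ↓ suc i = suc n * (n ↓ i)

↓-*-! : ∀ n i → i ≤ n → n ↓ i * (n ∸ i) ! ≡ n !
↓-*-! n       zero    _           = ℕ.+-identityʳ (n !)
↓-*-! (suc n) (suc i) (ℕ.s≤s i≤n) = trans (ℕ.*-assoc (suc n) (n ↓ i) _) (cong (suc n *_) (↓-*-! n i i≤n))

-- i counts the blocking containers above the highest non-blocking one.
orderingsWithBlocking-unrolled : ∀ n k →
  orderingsWithBlocking k (suc n) ≡ ∑[ i ∈ upTo (suc k) ] (n ↓ i * orderingsWithBlocking (k ∸ i) (n ∸ i))
orderingsWithBlocking-unrolled n k =
  trans (peel n k) (sym (∑∈-upTo-suc k (λ i → n ↓ i * orderingsWithBlocking (k ∸ i) (n ∸ i))))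
  where
  peel : ∀ n k → orderingsWithBlocking k (suc n) ≡
    1 * orderingsWithBlocking k n + ∑[ i ∈ upTo k ] (n ↓ suc i * orderingsWithBlocking (k ∸ suc i) (n ∸ suc i))
  peel n zero = begin
    orderingsWithBlocking 0 (suc n)     ≡⟨ orderingsWithBlocking-suc-zero n ⟩
    orderingsWithBlocking 0 n           ≡⟨ ℕ.*-identityˡ _ ⟨
    1 * orderingsWithBlocking 0 n       ≡⟨ ℕ.+-identityʳ _ ⟨
    1 * orderingsWithBlocking 0 n + 0   ∎
    where open ≡-Reasoning
  peel zero (suc k) = begin
    orderingsWithBlocking (suc k) 1                    ≡⟨ orderingsWithBlocking-suc-suc 0 k ⟩
    orderingsWithBlocking (suc k) 0 + 0                            ≡⟨ cong₂ _+_ (ℕ.*-identityˡ (orderingsWithBlocking (suc k) 0)) (∑∈-zero (upTo (suc k))) ⟨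
    1 * orderingsWithBlocking (suc k) 0 + ∑[ i ∈ upTo (suc k) ] 0  ∎
    where open ≡-Reasoning
  peel (suc n) (suc k) = begin
    orderingsWithBlocking (suc k) (suc (suc n))
      ≡⟨ orderingsWithBlocking-suc-suc (suc n) k ⟩
    orderingsWithBlocking (suc k) (suc n) + suc n * orderingsWithBlocking k (suc n)
      ≡⟨ cong₂ _+_ (sym (ℕ.*-identityˡ (orderingsWithBlocking (suc k) (suc n)))) (cong (suc n *_) (orderingsWithBlocking-unrolled n k)) ⟩
    1 * orderingsWithBlocking (suc k) (suc n) + suc n * ∑[ i ∈ upTo (suc k) ] (n ↓ i * orderingsWithBlocking (k ∸ i) (n ∸ i))
      ≡⟨ cong (1 * orderingsWithBlocking (suc k) (suc n) +_) (∑∈-*ˡ (upTo (suc k)) (suc n) _) ⟨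
    1 * orderingsWithBlocking (suc k) (suc n) + ∑[ i ∈ upTo (suc k) ] (suc n * (n ↓ i * orderingsWithBlocking (k ∸ i) (n ∸ i)))
      ≡⟨ cong (1 * orderingsWithBlocking (suc k) (suc n) +_) (∑∈-cong (upTo (suc k)) λ {i} _ → ℕ.*-assoc (suc n) (n ↓ i) _) ⟨
    1 * orderingsWithBlocking (suc k) (suc n) + ∑[ i ∈ upTo (suc k) ] (suc n ↓ suc i * orderingsWithBlocking (k ∸ i) (n ∸ i)) ∎
    where open ≡-Reasoning

totalBlocking : ℕ → ℕ
totalBlocking h = ∑[ σ ∈ perms h ] blockingInColumn (lookup σ)

∑-upTo-indicator : ∀ m (f : ℕ → ℕ) b → b ℕ.< m → ∑[ i ∈ upTo m ] (f i * 𝟙 (b ℕ.≡ᵇ i)) ≡ f b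
∑-upTo-indicator (suc m) f b b<m = trans (∑∈-upTo-suc m (λ i → f i * 𝟙 (b ℕ.≡ᵇ i))) (at b b<m)
  where
  at : ∀ b → b ℕ.< suc m → f 0 * 𝟙 (b ℕ.≡ᵇ 0) + ∑[ i ∈ upTo m ] (f (suc i) * 𝟙 (b ℕ.≡ᵇ suc i)) ≡ f b
  at zero    _ = begin
    f 0 * 1 + ∑[ i ∈ upTo m ] (f (suc i) * 0)  ≡⟨ cong₂ _+_ (ℕ.*-identityʳ (f 0)) (∑∈-cong (upTo m) λ {i} _ → ℕ.*-zeroʳ (f (suc i))) ⟩
    f 0 + ∑[ i ∈ upTo m ] 0                    ≡⟨ cong (f 0 +_) (∑∈-zero (upTo m)) ⟩
    f 0 + 0                                    ≡⟨ ℕ.+-identityʳ (f 0) ⟩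
    f 0                                        ∎
    where open ≡-Reasoning
  at (suc b) (ℕ.s≤s b<m) = trans (cong₂ _+_ (ℕ.*-zeroʳ (f 0)) refl) (∑-upTo-indicator m (f ∘ suc) b b<m)

∑-weights-indicator : ∀ m b → b ≤ m → ∑[ k ∈ map suc (upTo m) ] (k * 𝟙 (b ℕ.≡ᵇ k)) ≡ b
∑-weights-indicator m b b≤m = begin
  ∑[ k ∈ map suc (upTo m) ] (k * 𝟙 (b ℕ.≡ᵇ k))     ≡⟨ ∑∈-map suc (upTo m) (λ k → k * 𝟙 (b ℕ.≡ᵇ k)) ⟩
  ∑[ i ∈ upTo m ] (suc i * 𝟙 (b ℕ.≡ᵇ suc i))       ≡⟨ ∑∈-upTo-suc m (λ k → k * 𝟙 (b ℕ.≡ᵇ k)) ⟨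
  ∑[ k ∈ upTo (suc m) ] (k * 𝟙 (b ℕ.≡ᵇ k))         ≡⟨ ∑-upTo-indicator (suc m) id b (ℕ.s≤s b≤m) ⟩
  b                                                ∎
  where open ≡-Reasoning

∑-weighted-orderingsWithBlocking : ∀ h →
  ∑[ k ∈ map suc (upTo (h ∸ 1)) ] (k * orderingsWithBlocking k h) ≡ totalBlocking h
∑-weighted-orderingsWithBlocking h = begin
  ∑[ k ∈ ks ] (k * orderingsWithBlocking k h)
    ≡⟨ ∑∈-cong ks (λ {k} _ → trans (cong (k *_) (orderingsWithBlocking≡∑ k h)) (sym (∑∈-*ˡ (perms h) k _))) ⟩
  ∑[ k ∈ ks ] ∑[ σ ∈ perms h ] (k * 𝟙 (blocking σ ℕ.≡ᵇ k))
    ≡⟨ ∑∈-comm ks (perms h) (λ k σ → k * 𝟙 (blocking σ ℕ.≡ᵇ k)) ⟩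
  ∑[ σ ∈ perms h ] ∑[ k ∈ ks ] (k * 𝟙 (blocking σ ℕ.≡ᵇ k))
    ≡⟨ ∑∈-cong (perms h) (λ {σ} _ → ∑-weights-indicator (h ∸ 1) (blocking σ) (blockingInColumn≤ (lookup σ))) ⟩
  totalBlocking h ∎
  where
  open ≡-Reasoning
  ks = map suc (upTo (h ∸ 1))
  blocking : Vec (Fin h) h → ℕ
  blocking σ = blockingInColumn (lookup σ)

-- Bays

column : {C h : ℕ} → Fin C → Vec (Fin (C * h)) (C * h) → Fin h → Fin (C * h)
column i π j = lookup π (combine i j)

column-injective : {C h : ℕ} (i : Fin C) {π : Vec (Fin (C * h)) (C * h)} → π ∈ perms (C * h) →
                   Injective _≡_ _≡_ (column i π)
column-injective i {π} π∈ {j} {j'} eq = Fin.combine-injectiveʳ i j i j' (∈-perms⁻ π∈ eq)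

permuteTier : {C h : ℕ} → Fin C → (Fin h → Fin h) → Fin C → Fin h → Fin h
permuteTier i τ a b with a Fin.≟ i
... | yes _ = τ b
... | no  _ = b

permuteTier-self : {C h : ℕ} (i : Fin C) (τ : Fin h → Fin h) (b : Fin h) → permuteTier i τ i b ≡ τ b
permuteTier-self i τ b with i Fin.≟ i
... | yes _   = refl
... | no  i≢i = ⊥-elim (i≢i refl)

permuteTier-injective : {C h : ℕ} (i : Fin C) {τ : Fin h → Fin h} → Injective _≡_ _≡_ τ →
                        (a : Fin C) → Injective _≡_ _≡_ (permuteTier i τ a)
permuteTier-injective i τ-inj a with a Fin.≟ i
... | yes _ = τ-inj
... | no  _ = id

-- combine/remQuot identify Fin (C * h) with (column, tier) pairs: this permutes
-- the tiers of column i by τ and fixes every other column.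
permuteColumn : {C h : ℕ} → Fin C → (Fin h → Fin h) → Fin (C * h) → Fin (C * h)
permuteColumn {h = h} i τ p = Product.uncurry (λ a b → combine a (permuteTier i τ a b)) (remQuot h p)

permuteColumn-column : {C h : ℕ} (i : Fin C) (τ : Fin h → Fin h) (j : Fin h) →
                       permuteColumn i τ (combine i j) ≡ combine i (τ j)
permuteColumn-column {h = h} i τ j = trans
  (cong (Product.uncurry (λ a b → combine a (permuteTier i τ a b))) (Fin.remQuot-combine i j))
  (cong (combine i) (permuteTier-self i τ j))

permuteColumn-injective : {C h : ℕ} (i : Fin C) {τ : Fin h → Fin h} → Injective _≡_ _≡_ τ →
                          Injective _≡_ _≡_ (permuteColumn {C} i τ)
permuteColumn-injective {C} {h} i {τ} τ-inj {p} {q} eq = begin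
  p                                 ≡⟨ Fin.combine-remQuot {C} h p ⟨
  Product.uncurry combine (remQuot {C} h p) ≡⟨ cong (Product.uncurry combine) (on-pairs (remQuot h p) (remQuot h q) eq) ⟩
  Product.uncurry combine (remQuot {C} h q) ≡⟨ Fin.combine-remQuot {C} h q ⟩
  q                                 ∎
  where
  open ≡-Reasoning
  on-pairs : ∀ r r' → Product.uncurry (λ a b → combine a (permuteTier i τ a b)) r ≡
                      Product.uncurry (λ a b → combine a (permuteTier i τ a b)) r' → r ≡ r'
  on-pairs (a , b) (a' , b') e with Fin.combine-injective a _ a' _ e
  ... | refl , tiers≡ = cong (a ,_) (permuteTier-injective i τ-inj a tiers≡)

∑-perms-column-permute : {C h : ℕ} (i : Fin C) (σ : Vec (Fin h) h) → Injective _≡_ _≡_ (lookup σ) →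
  ∑[ π ∈ perms (C * h) ] blockingInColumn (column i π) ≡
  ∑[ π ∈ perms (C * h) ] blockingInColumn (column i π ∘ lookup σ)
∑-perms-column-permute {C} {h} i σ σ-inj = begin
  ∑[ π ∈ perms (C * h) ] blockingInColumn (column i π)
    ≡⟨ ∑-perms-reindex ρ (permuteColumn-injective i σ-inj) (blockingInColumn ∘ column i) ⟨
  ∑[ π ∈ perms (C * h) ] blockingInColumn (column i (reindex ρ π))
    ≡⟨ ∑∈-cong (perms (C * h)) (λ {π} _ → blockingInColumn-cong λ j →
         trans (lookup-reindex ρ π (combine i j)) (cong (lookup π) (permuteColumn-column i (lookup σ) j))) ⟩
  ∑[ π ∈ perms (C * h) ] blockingInColumn (column i π ∘ lookup σ) ∎
  where
  open ≡-Reasoning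
  ρ = permuteColumn i (lookup σ)

column-total : {C h : ℕ} (i : Fin C) →
  h ! * ∑[ π ∈ perms (C * h) ] blockingInColumn (column i π) ≡ (C * h) ! * totalBlocking h
column-total {C} {h} i = begin
  h ! * X                                                         ≡⟨ cong (_* X) (length-perms h) ⟨
  length (perms h) * X                                            ≡⟨ ∑∈-const (perms h) X ⟨
  ∑[ σ ∈ perms h ] X                                              ≡⟨ ∑∈-cong (perms h) (λ {σ} σ∈ → ∑-perms-column-permute i σ (∈-perms⁻ σ∈)) ⟩
  ∑[ σ ∈ perms h ] ∑[ π ∈ perms (C * h) ] blockingInColumn (column i π ∘ lookup σ)
    ≡⟨ ∑∈-comm (perms h) (perms (C * h)) (λ σ π → blockingInColumn (column i π ∘ lookup σ)) ⟩
  ∑[ π ∈ perms (C * h) ] ∑[ σ ∈ perms h ] blockingInColumn (column i π ∘ lookup σ)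
    ≡⟨ ∑∈-cong (perms (C * h)) (λ {π} π∈ → ∑-perms-blocking-relabel h (column i π) (column-injective i π∈) id) ⟩
  ∑[ π ∈ perms (C * h) ] totalBlocking h                          ≡⟨ ∑∈-const (perms (C * h)) (totalBlocking h) ⟩
  length (perms (C * h)) * totalBlocking h                        ≡⟨ cong (_* totalBlocking h) (length-perms (C * h)) ⟩
  (C * h) ! * totalBlocking h                                     ∎
  where
  open ≡-Reasoning
  X = ∑[ π ∈ perms (C * h) ] blockingInColumn (column i π)

bay-total : ∀ C h → h ! * ∑[ π ∈ perms (C * h) ] S₀ C h π ≡ C * ((C * h) ! * totalBlocking h)
bay-total C h = begin
  h ! * ∑[ π ∈ perms (C * h) ] ∑[ i ∈ allFin C ] blockingInColumn (column i π)
    ≡⟨ cong (h ! *_) (∑∈-comm (perms (C * h)) (allFin C) (λ π i → blockingInColumn (column i π))) ⟩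
  h ! * ∑[ i ∈ allFin C ] ∑[ π ∈ perms (C * h) ] blockingInColumn (column i π)
    ≡⟨ ∑∈-*ˡ (allFin C) (h !) _ ⟨
  ∑[ i ∈ allFin C ] (h ! * ∑[ π ∈ perms (C * h) ] blockingInColumn (column i π))
    ≡⟨ ∑∈-cong (allFin C) (λ {i} _ → column-total i) ⟩
  ∑[ i ∈ allFin C ] ((C * h) ! * totalBlocking h)  ≡⟨ ∑∈-const (allFin C) _ ⟩
  length (allFin C) * ((C * h) ! * totalBlocking h) ≡⟨ cong (_* ((C * h) ! * totalBlocking h)) (List.length-tabulate {n = C} id) ⟩
  C * ((C * h) ! * totalBlocking h)                ∎
  where open ≡-Reasoning

-- Fractions

infixl 7.5 _÷_

_÷_ : ℕ → (d : ℕ) → .{{ℕ.NonZero d}} → ℚ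
a ÷ d = ℤ.+ a / d

*≡*⇒÷≡ : ∀ a b c d .{{_ : ℕ.NonZero b}} .{{_ : ℕ.NonZero d}} → a * d ≡ c * b → a ÷ b ≡ c ÷ d
*≡*⇒÷≡ a (suc b) c (suc d) eq =
  ℚ.fromℚᵘ-cong {ℚᵘ.mkℚᵘ (ℤ.+ a) b} {ℚᵘ.mkℚᵘ (ℤ.+ c) d}
    (ℚᵘ.*≡* (trans (sym (ℤ.pos-* a (suc d))) (trans (cong ℤ.+_ eq) (ℤ.pos-* c (suc b)))))

÷-congʳ : ∀ a {b d} .{{_ : ℕ.NonZero b}} .{{_ : ℕ.NonZero d}} → b ≡ d → a ÷ b ≡ a ÷ d
÷-congʳ a refl = refl

÷≃ : ∀ a d → ℚ.toℚᵘ (a ÷ suc d) ℚᵘ.≃ ℚᵘ.mkℚᵘ (ℤ.+ a) d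
÷≃ a d = ℚ.toℚᵘ-fromℚᵘ (ℚᵘ.mkℚᵘ (ℤ.+ a) d)

≡-via-ℚᵘ : (p : ℚ) (x : ℚᵘ.ℚᵘ) → ℚ.toℚᵘ p ℚᵘ.≃ x → p ≡ ℚ.fromℚᵘ x
≡-via-ℚᵘ p x p≃x = trans (sym (ℚ.fromℚᵘ-toℚᵘ p)) (ℚ.fromℚᵘ-cong p≃x)

÷-+ : ∀ a b d .{{_ : ℕ.NonZero d}} → a ÷ d ℚ.+ b ÷ d ≡ (a + b) ÷ d
÷-+ a b (suc d) = ≡-via-ℚᵘ (a ÷ suc d ℚ.+ b ÷ suc d) (ℚᵘ.mkℚᵘ (ℤ.+ (a + b)) d)
  (ℚᵘ.≃-trans (ℚ.toℚᵘ-homo-+ (a ÷ suc d) (b ÷ suc d))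
    (ℚᵘ.≃-trans (ℚᵘ.+-cong (÷≃ a d) (÷≃ b d)) (ℚᵘ.*≡* (trans (distrib (ℤ.+ a) (ℤ.+ b) (ℤ.+ suc d))
      (cong (ℤ._* (ℤ.+ suc d ℤ.* ℤ.+ suc d)) (sym (ℤ.pos-+ a b)))))))
  where
  distrib : ∀ x y z → (x ℤ.* z ℤ.+ y ℤ.* z) ℤ.* z ≡ (x ℤ.+ y) ℤ.* (z ℤ.* z)
  distrib = ℤ-Solver.solve-∀

÷-* : ∀ a b c d .{{_ : ℕ.NonZero b}} .{{_ : ℕ.NonZero d}} →
      a ÷ b ℚ.* c ÷ d ≡ ((a * c) ÷ (b * d)) {{ℕ.m*n≢0 b d}}
÷-* a (suc b) c (suc d) = ≡-via-ℚᵘ (a ÷ suc b ℚ.* c ÷ suc d) (ℚᵘ.mkℚᵘ (ℤ.+ (a * c)) (d + b * suc d))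
  (ℚᵘ.≃-trans (ℚ.toℚᵘ-homo-* (a ÷ suc b) (c ÷ suc d))
    (ℚᵘ.≃-trans (ℚᵘ.*-cong (÷≃ a b) (÷≃ c d))
      (ℚᵘ.≃-reflexive (cong (λ z → ℚᵘ.mkℚᵘ z (d + b * suc d)) (sym (ℤ.pos-* a c))))))

sumℚ-÷ : (xs : List A) (f : A → ℕ) (d : ℕ) .{{_ : ℕ.NonZero d}} →
         sumℚ (map (λ x → f x ÷ d) xs) ≡ (∑[ x ∈ xs ] f x) ÷ d
sumℚ-÷ []       f d = sym (ℚ.0/n≡0 d)
sumℚ-÷ (x ∷ xs) f d = trans (cong (f x ÷ d ℚ.+_) (sumℚ-÷ xs f d)) (÷-+ (f x) _ d)

α≡ : ∀ h → α h ≡ (totalBlocking h ÷ h !) {{h ℕ.!≢0}}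
α≡ h = begin
  α h                                                  ≡⟨ cong sumℚ (List.map-cong term ks) ⟩
  sumℚ (map (λ k → (k * orderingsWithBlocking k h) ÷ h !) ks) ≡⟨ sumℚ-÷ ks (λ k → k * orderingsWithBlocking k h) (h !) ⟩
  (∑[ k ∈ ks ] (k * orderingsWithBlocking k h)) ÷ h !  ≡⟨ cong (_÷ h !) (∑-weighted-orderingsWithBlocking h) ⟩
  totalBlocking h ÷ h !                                ∎
  where
  open ≡-Reasoning
  instance
    h!≢0 : ℕ.NonZero (h !)
    h!≢0 = h ℕ.!≢0
  ks = map suc (upTo (h ∸ 1))
  term : ∀ k → k ÷ 1 ℚ.* p k h ≡ (k * orderingsWithBlocking k h) ÷ h !
  term k = trans (÷-* k 1 (orderingsWithBlocking k h) (h !))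
                 (÷-congʳ (k * orderingsWithBlocking k h) {{ℕ.m*n≢0 1 (h !)}} (ℕ.*-identityˡ (h !)))

expectedS₀≡ : ∀ C h → expectedS₀ C h ≡ α h ℚ.* ofℕ C
expectedS₀≡ C h = begin
  expectedS₀ C h                              ≡⟨ *≡*⇒÷≡ S ((C * h) !) (t * C) (h ! * 1) {{(C * h) ℕ.!≢0}} {{ℕ.m*n≢0 (h !) 1}} cross ⟩
  ((t * C) ÷ (h ! * 1)) {{ℕ.m*n≢0 (h !) 1}}   ≡⟨ ÷-* t (h !) C 1 ⟨
  t ÷ h ! ℚ.* C ÷ 1                           ≡⟨ cong (ℚ._* ofℕ C) (α≡ h) ⟨
  α h ℚ.* ofℕ C                               ∎
  where
  open ≡-Reasoning
  instance
    h!≢0 : ℕ.NonZero (h !)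
    h!≢0 = h ℕ.!≢0
  S = ∑[ π ∈ perms (C * h) ] S₀ C h π
  t = totalBlocking h
  cross : S * (h ! * 1) ≡ t * C * (C * h) !
  cross = begin
    S * (h ! * 1)              ≡⟨ cong (S *_) (ℕ.*-identityʳ (h !)) ⟩
    S * h !                    ≡⟨ ℕ.*-comm S (h !) ⟩
    h ! * S                    ≡⟨ bay-total C h ⟩
    C * ((C * h) ! * t)        ≡⟨ reorder C ((C * h) !) t ⟩
    t * C * (C * h) !          ∎
    where
    reorder : ∀ c f t → c * (f * t) ≡ t * c * f
    reorder = ℕ-Solver.solve-∀

p-zero : ∀ m → p 0 m ≡ invFact m
p-zero m = cong (λ c → (c ÷ m !) {{m ℕ.!≢0}}) (orderingsWithBlocking-zero m)

oneOver*p≡ : ∀ n k i → i ≤ n →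
  oneOver (suc n) ℚ.* p (k ∸ i) (n ∸ i) ≡ ((n ↓ i * orderingsWithBlocking (k ∸ i) (n ∸ i)) ÷ suc n !) {{suc n ℕ.!≢0}}
oneOver*p≡ n k i i≤n =
  trans (÷-* 1 (suc n) c r {{_}} {{(n ∸ i) ℕ.!≢0}})
        (*≡*⇒÷≡ (1 * c) (suc n * r) (n ↓ i * c) (suc n !) {{ℕ.m*n≢0 (suc n) r {{_}} {{(n ∸ i) ℕ.!≢0}}}} {{suc n ℕ.!≢0}} cross)
  where
  c = orderingsWithBlocking (k ∸ i) (n ∸ i)
  r = (n ∸ i) !
  reorder : ∀ c m f r → 1 * c * (m * (f * r)) ≡ f * c * (m * r)
  reorder = ℕ-Solver.solve-∀
  cross : 1 * c * suc n ! ≡ n ↓ i * c * (suc n * r)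
  cross = trans (cong (λ x → 1 * c * (suc n * x)) (sym (↓-*-! n i i≤n))) (reorder c (suc n) (n ↓ i) r)

p-recurrence : ∀ n k → k ≤ n →
  p k (suc n) ≡ sumℚ (map (λ j → oneOver (suc n) ℚ.* p (suc k ∸ j) (suc n ∸ j)) (map suc (upTo (suc k))))
p-recurrence n k k≤n = begin
  p k (suc n)                                              ≡⟨ cong (_÷ suc n !) (orderingsWithBlocking-unrolled n k) ⟩
  (∑[ i ∈ upTo (suc k) ] term i) ÷ suc n !                 ≡⟨ sumℚ-÷ (upTo (suc k)) term (suc n !) ⟨
  sumℚ (map (λ i → term i ÷ suc n !) (upTo (suc k)))
    ≡⟨ cong sumℚ (List.map-cong-local (ListAll.tabulate λ i∈ →
         sym (oneOver*p≡ n k _ (ℕ.≤-trans (ℕ.≤-pred (∈.∈-upTo⁻ i∈)) k≤n)))) ⟩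
  sumℚ (map (φ ∘ suc) (upTo (suc k)))                      ≡⟨ cong sumℚ (List.map-∘ {g = φ} {f = suc} (upTo (suc k))) ⟩
  sumℚ (map φ (map suc (upTo (suc k))))                    ∎
  where
  open ≡-Reasoning
  instance
    [suc-n]!≢0 : ℕ.NonZero (suc n !)
    [suc-n]!≢0 = suc n ℕ.!≢0
  term : ℕ → ℕ
  term i = n ↓ i * orderingsWithBlocking (k ∸ i) (n ∸ i)
  φ : ℕ → ℚ
  φ j = oneOver (suc n) ℚ.* p (suc k ∸ j) (suc n ∸ j)

proposition7 : (P C h : ℕ) → 3 ≤ P → h ≤ P ∸ 1 →
      (expectedS₀ C h ≡ α h ℚ.* ofℕ C)
    × ((m : ℕ) → p 0 m ≡ invFact m)
    × ((k : ℕ) → 1 ≤ k → k ≤ h ∸ 1 →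
         p k h ≡ sumℚ (map (λ j → oneOver h ℚ.* p (k + 1 ∸ j) (h ∸ j)) (map suc (upTo (k + 1)))))
proposition7 P C h _ _ = expectedS₀≡ C h , p-zero , recurrence h
  where
  recurrence : ∀ h k → 1 ≤ k → k ≤ h ∸ 1 →
    p k h ≡ sumℚ (map (λ j → oneOver h ℚ.* p (k + 1 ∸ j) (h ∸ j)) (map suc (upTo (k + 1))))
  recurrence zero    (suc k) _ ()
  recurrence (suc n) k       _ k≤n =
    subst (λ K → p k (suc n) ≡ sumℚ (map (λ j → oneOver (suc n) ℚ.* p (K ∸ j) (suc n ∸ j)) (map suc (upTo K))))
          (ℕ.+-comm 1 k) (p-recurrence n k k≤n)
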